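{- Let $\mathcal{G}=(G,w_+,w_-,W)$ be a $1$-balanced weighted graph, and let $S\subseteq V(G)$ with $|\Gamma_G(S)|\le1$. Then $Z(\mathrm{Prune}(\mathcal{G},S))=Z(\mathcal{G})$ and $\mathrm{Prune}(\mathcal{G},S)$ is $1$-balanced.
   Context: A weighted graph $\mathcal{G}=(G,w_+,w_-,W)$ consists of a graph $G$, positive-integer-valued functions $w_+,w_-$ on (a domain containing) $V(G)$, and a positive integer $W$. For $X\subseteq V(G)$, $w_\pm(X)=\prod_{x\in X}w_\pm(x)$ (empty product $=1$). $Z(\mathcal{G})=W\sum_{I}w_+(I)\,w_-(V(G)\setminus I)$, summing over independent sets $I$ of $G$ (if $G$ has no vertices, $Z(\mathcal{G})=W$). $\mathcal{G}$ is $1$-balanced if $w_+(v)\le w_-(v)$ for all $v\in V(G)$. For $X\subseteq V(G)$, $\mathcal{G}-X=(G-X,w_+,w_-,W)$ and $\mathcal{G}[X]=(G[X],w_+,w_-,W)$; $\Gamma_G(v)$ is the neighbourhood of $v$ and $\Gamma_G(S)=\bigcup_{v\in S}\Gamma_G(v)\setminus S$. For $S$ with $|\Gamma_G(S)|\le1$, $\mathrm{Prune}(\mathcal{G},S)$ is defined as follows. If $\Gamma_G(S)=\emptyset$, it is $(G-S,w_+,w_-,Z(G[S],w_+,w_-,W))$. If $\Gamma_G(S)=\{v\}$, let $S'=S\cap\Gamma_G(v)$ and $S''=S\setminus\Gamma_G(v)$; then it is $(G-S,w_+',w_-',W)$ where $w_+'(v)=w_+(v)\,w_-(S')\,Z(G[S''],w_+,w_-,1)$,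 $w_-'(v)=w_-(v)\,Z(G[S],w_+,w_-,1)$, and $w_\pm'(x)=w_\pm(x)$ for $x\ne v$. -}

module Defs where

open import Data.Bool using (Bool; true; false; if_then_else_; _∧_; _∨_; not)
open import Data.Nat using (ℕ; zero; suc; _+_; _*_; _≤_; _<_)
open import Data.Fin using (Fin; zero; suc; _≟_)
open import Data.Fin.Subset using (Subset; inside; outside; _∈_; _∩_; _─_)
open import Data.Vec using (Vec; []; _∷_; lookup; tabulate)
open import Data.List using (List; []; _∷_; _++_; map; allFin)
open import Data.Bool.ListAction using (and; or)
open import Data.Nat.ListAction using (sum)
open import Data.Maybe using (Maybe; just; nothing)
open import Relation.Nullary using (yes; no)
open import Relation.Binary.PropositionalEquality using (_≡_)

-- The edges of the graph are the adjacencies between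
-- vertices of V.  The weight functions live on all of Fin n
-- ("a domain containing V(G)").
record WGraph (n : ℕ) : Set where
  field
    adj     : Fin n → Fin n → Bool
    adj-sym : ∀ u v → adj u v ≡ adj v u
    adj-irr : ∀ v → adj v v ≡ false
    V       : Subset n
    w+      : Fin n → ℕ
    w-      : Fin n → ℕ
    W       : ℕ
open WGraph public

IsWeighted : ∀ {n} → WGraph n → Set
IsWeighted 𝒢 = (∀ v → 0 < w+ 𝒢 v) × (∀ v → 0 < w- 𝒢 v) × (0 < W 𝒢)
  where open import Data.Product using (_×_)

OneBalanced : ∀ {n} → WGraph n → Set
OneBalanced 𝒢 = ∀ v → v ∈ V 𝒢 → w+ 𝒢 v ≤ w- 𝒢 v

allSubsets : ∀ n → List (Subset n)
allSubsets zero    = [] ∷ []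
allSubsets (suc n) = map (outside ∷_) (allSubsets n) ++ map (inside ∷_) (allSubsets n)

prodOn : ∀ {n} → Subset n → (Fin n → ℕ) → ℕ
prodOn []            f = 1
prodOn (true  ∷ s) f = f zero * prodOn s (λ i → f (suc i))
prodOn (false ∷ s) f = prodOn s (λ i → f (suc i))

subsetB : ∀ {n} → Subset n → Subset n → Bool
subsetB {n} I X = and (map (λ i → not (lookup I i) ∨ lookup X i) (allFin n))

independentB : ∀ {n} → (Fin n → Fin n → Bool) → Subset n → Bool
independentB {n} a I =
  and (map (λ i → and (map (λ j → not (lookup I i ∧ lookup I j ∧ a i j)) (allFin n))) (allFin n))

-- Z(G[X], w+, w-, W') where G has adjacency a; the sum is over independent
-- subsets I of X of w+(I) w-(X ∖ I), times W'.  (X empty gives W'.)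
Zon : ∀ {n} → (Fin n → Fin n → Bool) → Subset n → (Fin n → ℕ) → (Fin n → ℕ) → ℕ → ℕ
Zon {n} a X p m W' =
  W' * sum (map (λ I → if subsetB I X ∧ independentB a I
                         then prodOn I p * prodOn (X ─ I) m
                         else 0)
                (allSubsets n))

Z : ∀ {n} → WGraph n → ℕ
Z 𝒢 = Zon (adj 𝒢) (V 𝒢) (w+ 𝒢) (w- 𝒢) (W 𝒢)

nbr : ∀ {n} → WGraph n → Fin n → Subset n
nbr 𝒢 v = tabulate (λ u → lookup (V 𝒢) u ∧ adj 𝒢 v u)

nbrSet : ∀ {n} → WGraph n → Subset n → Subset n
nbrSet {n} 𝒢 S = tabulate (λ u →
  lookup (V 𝒢) u ∧ not (lookup S u) ∧
  or (map (λ v → lookup S v ∧ lookup (V 𝒢) v ∧ adj 𝒢 v u) (allFin n)))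

firstIn : ∀ {n} → Subset n → Maybe (Fin n)
firstIn []            = nothing
firstIn (true  ∷ s) = just zero
firstIn (false ∷ s) with firstIn s
... | just i  = just (suc i)
... | nothing = nothing

upd : ∀ {n} → (Fin n → ℕ) → Fin n → ℕ → Fin n → ℕ
upd f v k x with x ≟ v
... | yes _ = k
... | no  _ = f x

-- Prune(𝒢, S), intended for S ⊆ V(G) with |Γ_G(S)| ≤ 1 (so Γ_G(S) is
-- either empty or the singleton {v} with v its first element).
Prune : ∀ {n} → WGraph n → Subset n → WGraph n
Prune 𝒢 S with firstIn (nbrSet 𝒢 S)
... | nothing = record 𝒢
  { V = V 𝒢 ─ S
  ; W = Zon (adj 𝒢) S (w+ 𝒢) (w- 𝒢) (W 𝒢) }
... | just v = record 𝒢
  { V  = V 𝒢 ─ S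
  ; w+ = upd (w+ 𝒢) v (w+ 𝒢 v * prodOn S' (w- 𝒢) * Zon (adj 𝒢) S'' (w+ 𝒢) (w- 𝒢) 1)
  ; w- = upd (w- 𝒢) v (w- 𝒢 v * Zon (adj 𝒢) S (w+ 𝒢) (w- 𝒢) 1) }
  where
    S'  = S ∩ nbr 𝒢 v
    S'' = S ─ nbr 𝒢 v

module Submission where

-- Write a summand of Z as a product over the vertices x of V, with factor w₊(x) if x ∈ I and
-- w₋(x) otherwise.  An independent set I of G is the disjoint union of J = I ∩ S and
-- K = I ∖ S, and its summand is the product of the summands of J in G[S] and of K in G[V ∖ S];
-- conversely such a pair gives an independent set unless an edge joins J to K.  If Γ(S) = ∅ no
-- pair is excluded, so Z(𝒢) = W · Z(G[S]) · Z(G[V ∖ S]).  If Γ(S) = {v}, only pairs with v ∈ K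
-- and J ∩ Γ(v) ≠ ∅ are excluded, so summing over J for fixed K gives Z(G[S]) when v ∉ K and
-- w₋(S') Z(G[S'']) when v ∈ K: these are the factors by which Prune rescales w₋(v) and w₊(v).
-- Balance at v holds since adding S' to an independent subset of S'' keeps it independent in
-- G[S], whence w₋(S') Z(G[S'']) ≤ Z(G[S]).

open import Defs
open import Data.Bool using (Bool; true; false; T; not; _∧_; _∨_; if_then_else_)
open import Data.Bool.Properties using (T-≡; T-∧; T?)
open import Data.Bool.ListAction using (all; any)
open import Data.Fin using (Fin; zero; suc; _≟_)
open import Data.Fin.Properties using (suc-injective)
open import Data.Fin.Subset using (Subset; inside; outside; _∈_; _∉_; _⊆_; _∪_; _∩_; _─_; ∣_∣)
open import Data.Fin.Subset.Properties
  using (∣p∣≤∣x∷p∣; drop-∷-⊆; p⊆p∪q; q⊆p∪q; x∈p∪q⁻; x∈p∧x∉q⇒x∈p─q; p─q⊆p)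
open import Data.List using (map; _++_; allFin)
open import Data.List.Properties using (map-++; map-∘)
open import Data.List.Membership.Propositional using (lose)
open import Data.List.Membership.Propositional.Properties using (∈-allFin)
import Data.List.Relation.Unary.All as All
open import Data.List.Relation.Unary.All.Properties using (all⁺; all⁻)
open import Data.List.Relation.Unary.Any.Properties using (any⁺)
open import Data.Maybe using (just; nothing)
open import Data.Nat using (ℕ; zero; suc; _+_; _*_; _≤_; z≤n; s≤s)
open import Data.Nat.Properties
  using ( ≤-reflexive; ≤-trans; module ≤-Reasoning; +-identityʳ; *-identityˡ; *-assoc; *-comm
        ; *-zeroʳ; *-distribˡ-+; +-mono-≤; *-mono-≤; +-commutativeSemigroup; *-commutativeSemigroup)
open import Data.Nat.ListAction using (sum)
open import Data.Nat.ListAction.Properties using (sum-++)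
open import Data.Product using (_×_; _,_; proj₁; proj₂)
open import Data.Sum using (inj₁; inj₂)
open import Data.Vec using ([]; _∷_; lookup; here; there)
open import Data.Vec.Properties using (lookup⇒[]=; []=⇒lookup; lookup∘tabulate)
import Algebra.Properties.CommutativeSemigroup as CommSemigroupProperties
open import Function using (_∘_; Equivalence)
open import Relation.Binary.PropositionalEquality
open import Relation.Nullary using (¬_; Dec; yes; no; contradiction)
open import Relation.Nullary.Decidable using (map′)

private
  variable
    n : ℕ

module +-CS = CommSemigroupProperties +-commutativeSemigroup
module *-CS = CommSemigroupProperties *-commutativeSemigroup

T-∧ʳ : ∀ {x y} → T (x ∧ y) → T y
T-∧ʳ {true} t = t

T-not-∨⁻ : ∀ {x y} → T (not x ∨ y) → T x → T y
T-not-∨⁻ {true} t _ = t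

T-not-∨⁺ : ∀ {x y} → (T x → T y) → T (not x ∨ y)
T-not-∨⁺ {true}  h = h _
T-not-∨⁺ {false} h = _

T-not-∧³⁻ : ∀ {x y z} → T (not (x ∧ y ∧ z)) → T x → T y → ¬ T z
T-not-∧³⁻ {true} {true} {true}  ()
T-not-∧³⁻ {true} {true} {false} _ _ _ ()

T-not-∧³⁺ : ∀ {x y z} → (T x → T y → ¬ T z) → T (not (x ∧ y ∧ z))
T-not-∧³⁺ {true}  {true}  {true}  h = h _ _ _
T-not-∧³⁺ {true}  {true}  {false} h = _
T-not-∧³⁺ {true}  {false}         h = _
T-not-∧³⁺ {false}                 h = _

if-T : ∀ {b} {x y : ℕ} → T b → (if b then x else y) ≡ x
if-T {true} _ = refl

if-¬T : ∀ {b} {x y : ℕ} → ¬ T b → (if b then x else y) ≡ y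
if-¬T {true}  ¬t = contradiction _ ¬t
if-¬T {false} _  = refl

T-lookup⇒∈ : ∀ {X : Subset n} {i} → T (lookup X i) → i ∈ X
T-lookup⇒∈ {X = X} {i} t = lookup⇒[]= i X (Equivalence.to T-≡ t)

∈⇒T-lookup : ∀ {X : Subset n} {i} → i ∈ X → T (lookup X i)
∈⇒T-lookup i∈X = Equivalence.from T-≡ ([]=⇒lookup i∈X)

T-not-lookup⇒∉ : ∀ {X : Subset n} {i} → T (not (lookup X i)) → i ∉ X
T-not-lookup⇒∉ t i∈X = subst (T ∘ not) ([]=⇒lookup i∈X) t

∉⇒T-not-lookup : ∀ {X : Subset n} {i} → i ∉ X → T (not (lookup X i))
∉⇒T-not-lookup {X = X} {i} i∉X with lookup X i in e
... | true  = i∉X (lookup⇒[]= i X e)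
... | false = _

x∈p─q⇒x∉q : ∀ {p q : Subset n} {x} → x ∈ p ─ q → x ∉ q
x∈p─q⇒x∉q {p = inside ∷ p} {outside ∷ q} here        ()
x∈p─q⇒x∉q {p = s ∷ p}      {t ∷ q}       (there x∈) (there x∈q) = x∈p─q⇒x∉q x∈ x∈q

∣p∣≤0⇒x∉p : ∀ {p : Subset n} {x} → ∣ p ∣ ≤ 0 → x ∉ p
∣p∣≤0⇒x∉p {p = inside ∷ p} ()
∣p∣≤0⇒x∉p {p = s ∷ p}      ∣p∣≤0 (there x∈p) =
  ∣p∣≤0⇒x∉p (≤-trans (∣p∣≤∣x∷p∣ s p) ∣p∣≤0) x∈p

∣p∣≤1⇒x≡y : ∀ {p : Subset n} {x y} → ∣ p ∣ ≤ 1 → x ∈ p → y ∈ p → x ≡ y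
∣p∣≤1⇒x≡y _           here        here        = refl
∣p∣≤1⇒x≡y (s≤s ∣p∣≤0) here        (there y∈p) = contradiction y∈p (∣p∣≤0⇒x∉p ∣p∣≤0)
∣p∣≤1⇒x≡y (s≤s ∣p∣≤0) (there x∈p) here        = contradiction x∈p (∣p∣≤0⇒x∉p ∣p∣≤0)
∣p∣≤1⇒x≡y {p = s ∷ p} ∣p∣≤1 (there x∈p) (there y∈p) =
  cong suc (∣p∣≤1⇒x≡y (≤-trans (∣p∣≤∣x∷p∣ s p) ∣p∣≤1) x∈p y∈p)

firstIn-nothing : ∀ {X : Subset n} {x} → firstIn X ≡ nothing → x ∉ X
firstIn-nothing {X = inside ∷ X}  ()
firstIn-nothing {X = outside ∷ X} eq (there x∈X) with firstIn X in eq′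
firstIn-nothing {X = outside ∷ X} () (there x∈X) | just _
... | nothing = firstIn-nothing eq′ x∈X

firstIn-just : ∀ {X : Subset n} {v} → firstIn X ≡ just v → v ∈ X
firstIn-just {X = inside ∷ X}  refl = here
firstIn-just {X = outside ∷ X} eq with firstIn X in eq′
firstIn-just {X = outside ∷ X} refl | just _ = there (firstIn-just eq′)
firstIn-just {X = outside ∷ X} ()   | nothing

all-allFin⁻ : ∀ (f : Fin n → Bool) → T (all f (allFin n)) → ∀ i → T (f i)
all-allFin⁻ f t i = All.lookup (all⁺ f (allFin _) t) (∈-allFin i)

all-allFin⁺ : ∀ (f : Fin n → Bool) → (∀ i → T (f i)) → T (all f (allFin n))
all-allFin⁺ f h = all⁻ f {allFin _} (All.tabulate λ {i} _ → h i)

any-allFin⁺ : ∀ (f : Fin n → Bool) i → T (f i) → T (any f (allFin n))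
any-allFin⁺ f i t = any⁺ f (lose (∈-allFin i) t)

subsetB-sound : ∀ {I X : Subset n} → T (subsetB I X) → I ⊆ X
subsetB-sound {I = I} {X} t {i} i∈I =
  T-lookup⇒∈ (T-not-∨⁻ (all-allFin⁻ (λ i → not (lookup I i) ∨ lookup X i) t i) (∈⇒T-lookup i∈I))

subsetB-complete : ∀ {I X : Subset n} → I ⊆ X → T (subsetB I X)
subsetB-complete {I = I} {X} I⊆X =
  all-allFin⁺ (λ i → not (lookup I i) ∨ lookup X i) λ i → T-not-∨⁺ (∈⇒T-lookup ∘ I⊆X ∘ T-lookup⇒∈)

module _ (a : Fin n → Fin n → Bool) where

  Independent : Subset n → Set
  Independent I = ∀ {i j} → i ∈ I → j ∈ I → ¬ T (a i j)

  private
    edgeFree : Subset n → Fin n → Fin n → Bool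
    edgeFree I i j = not (lookup I i ∧ lookup I j ∧ a i j)

  independentB-sound : ∀ {I} → T (independentB a I) → Independent I
  independentB-sound {I} t {i} {j} i∈I j∈I =
    T-not-∧³⁻ (all-allFin⁻ (edgeFree I i) (all-allFin⁻ (λ i → all (edgeFree I i) (allFin n)) t i) j)
              (∈⇒T-lookup i∈I) (∈⇒T-lookup j∈I)

  independentB-complete : ∀ {I} → Independent I → T (independentB a I)
  independentB-complete {I} ind =
    all-allFin⁺ (λ i → all (edgeFree I i) (allFin n)) λ i → all-allFin⁺ (edgeFree I i) λ j →
      T-not-∧³⁺ λ ti tj → ind (T-lookup⇒∈ ti) (T-lookup⇒∈ tj)

∑ : (Subset n → ℕ) → ℕ
∑ {zero}  f = f []
∑ {suc n} f = ∑ (f ∘ (outside ∷_)) + ∑ (f ∘ (inside ∷_))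

∑₂ : (Subset n → Subset n → ℕ) → ℕ
∑₂ G = ∑ λ J → ∑ (G J)

sum-allSubsets : ∀ (f : Subset n → ℕ) → sum (map f (allSubsets n)) ≡ ∑ f
sum-allSubsets {zero}  f = +-identityʳ (f [])
sum-allSubsets {suc n} f = begin
  sum (map f (map (outside ∷_) As ++ map (inside ∷_) As))
    ≡⟨ cong sum (map-++ f (map (outside ∷_) As) _) ⟩
  sum (map f (map (outside ∷_) As) ++ map f (map (inside ∷_) As))
    ≡⟨ sum-++ (map f (map (outside ∷_) As)) _ ⟩
  sum (map f (map (outside ∷_) As)) + sum (map f (map (inside ∷_) As))
    ≡⟨ cong₂ _+_ (cong sum (map-∘ As)) (cong sum (map-∘ As)) ⟨
  sum (map (f ∘ (outside ∷_)) As) + sum (map (f ∘ (inside ∷_)) As)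
    ≡⟨ cong₂ _+_ (sum-allSubsets (f ∘ (outside ∷_))) (sum-allSubsets (f ∘ (inside ∷_))) ⟩
  ∑ f ∎
  where
  open ≡-Reasoning
  As = allSubsets n

∑-cong : ∀ {f g : Subset n → ℕ} → (∀ I → f I ≡ g I) → ∑ f ≡ ∑ g
∑-cong {zero}  f≗g = f≗g []
∑-cong {suc n} f≗g = cong₂ _+_ (∑-cong (f≗g ∘ (outside ∷_))) (∑-cong (f≗g ∘ (inside ∷_)))

∑-zero : ∑ {n} (λ _ → 0) ≡ 0
∑-zero {zero}  = refl
∑-zero {suc n} = cong₂ _+_ (∑-zero {n}) (∑-zero {n})

∑-+ : ∀ (f g : Subset n → ℕ) → ∑ (λ I → f I + g I) ≡ ∑ f + ∑ g
∑-+ {zero}  f g = refl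
∑-+ {suc n} f g =
  trans (cong₂ _+_ (∑-+ (f ∘ (outside ∷_)) (g ∘ (outside ∷_)))
                   (∑-+ (f ∘ (inside ∷_)) (g ∘ (inside ∷_))))
        (+-CS.interchange (∑ (f ∘ (outside ∷_))) (∑ (g ∘ (outside ∷_))) _ _)

∑-*ˡ : ∀ c (f : Subset n → ℕ) → ∑ (λ I → c * f I) ≡ c * ∑ f
∑-*ˡ {zero}  c f = refl
∑-*ˡ {suc n} c f =
  trans (cong₂ _+_ (∑-*ˡ c (f ∘ (outside ∷_))) (∑-*ˡ c (f ∘ (inside ∷_)))) (sym (*-distribˡ-+ c _ _))

∑-*ʳ : ∀ c (f : Subset n → ℕ) → ∑ (λ I → f I * c) ≡ ∑ f * c
∑-*ʳ c f = trans (∑-cong λ I → *-comm (f I) c) (trans (∑-*ˡ c f) (*-comm c (∑ f)))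

∑-mono : ∀ {f g : Subset n → ℕ} → (∀ I → f I ≤ g I) → ∑ f ≤ ∑ g
∑-mono {zero}  f≤g = f≤g []
∑-mono {suc n} f≤g = +-mono-≤ (∑-mono (f≤g ∘ (outside ∷_))) (∑-mono (f≤g ∘ (inside ∷_)))

∑-swap : ∀ {k} (G : Subset n → Subset k → ℕ) → ∑ (λ J → ∑ (G J)) ≡ ∑ (λ K → ∑ (λ J → G J K))
∑-swap {zero}  G = refl
∑-swap {suc n} G =
  trans (cong₂ _+_ (∑-swap (G ∘ (outside ∷_))) (∑-swap (G ∘ (inside ∷_))))
        (sym (∑-+ (λ K → ∑ (λ J → G (outside ∷ J) K)) (λ K → ∑ (λ J → G (inside ∷ J) K))))

splits : Subset n → Subset n → Subset n → Bool
splits []      []      []      = true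
splits (s ∷ S) (j ∷ J) (k ∷ K) = (if s then not k else not j) ∧ splits S J K

splits⇒⊆ : ∀ {S J K : Subset n} → T (splits S J K) → J ⊆ S
splits⇒⊆ {S = inside ∷ S} {inside ∷ J} {outside ∷ K} sp here        = here
splits⇒⊆ {S = s ∷ S}      {j ∷ J}      {k ∷ K}       sp (there x∈J) = there (splits⇒⊆ (T-∧ʳ sp) x∈J)

splits⇒disjoint : ∀ {S J K : Subset n} {x} → T (splits S J K) → x ∈ K → x ∉ S
splits⇒disjoint {S = inside ∷ S} {j ∷ J} {inside ∷ K} () here here
splits⇒disjoint {S = s ∷ S}      {j ∷ J} {k ∷ K}      sp (there x∈K) (there x∈S) =
  splits⇒disjoint (T-∧ʳ sp) x∈K x∈S

splits-complete : ∀ {S J K : Subset n} → J ⊆ S → (∀ {x} → x ∈ K → x ∉ S) → T (splits S J K)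
splits-complete {S = []}          {[]}          {[]}          _   _    = _
splits-complete {S = inside ∷ S}  {j ∷ J}       {outside ∷ K} J⊆S K∩S =
  splits-complete (drop-∷-⊆ J⊆S) λ x∈K x∈S → K∩S (there x∈K) (there x∈S)
splits-complete {S = inside ∷ S}  {j ∷ J}       {inside ∷ K}  J⊆S K∩S = contradiction here (K∩S here)
splits-complete {S = outside ∷ S} {outside ∷ J} {k ∷ K}       J⊆S K∩S =
  splits-complete (drop-∷-⊆ J⊆S) λ x∈K x∈S → K∩S (there x∈K) (there x∈S)
splits-complete {S = outside ∷ S} {inside ∷ J}  {k ∷ K}       J⊆S K∩S = contradiction (J⊆S here) λ ()

∑-splits : ∀ (S : Subset n) (f : Subset n → ℕ) →
           ∑ f ≡ ∑₂ λ J K → if splits S J K then f (J ∪ K) else 0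
∑-splits []                    f = refl
∑-splits {suc n} (inside ∷ S)  f = cong₂ _+_ (with-empty-tail outside) (with-empty-tail inside)
  where
  A : Bool → Subset n → ℕ
  A j J = ∑ λ K → if splits S J K then f (j ∷ J ∪ K) else 0
  +-∑-zero : ∀ x → x + ∑ {n} (λ _ → 0) ≡ x
  +-∑-zero x = trans (cong (x +_) (∑-zero {n})) (+-identityʳ x)
  with-empty-tail : ∀ j → ∑ (f ∘ (j ∷_)) ≡ ∑ λ J → A j J + ∑ {n} (λ _ → 0)
  with-empty-tail j = trans (∑-splits S (f ∘ (j ∷_))) (∑-cong {n} λ J → sym (+-∑-zero (A j J)))
∑-splits {suc n} (outside ∷ S) f = sym (begin
  ∑ (λ J → A outside J + A inside J) + ∑ {n} (λ _ → ∑ {n} (λ _ → 0) + ∑ {n} (λ _ → 0))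
    ≡⟨ cong₂ _+_ (∑-+ (A outside) (A inside))
                 (trans (∑-cong {n} λ _ → cong₂ _+_ (∑-zero {n}) (∑-zero {n})) (∑-zero {n})) ⟩
  ∑ (A outside) + ∑ (A inside) + 0
    ≡⟨ +-identityʳ _ ⟩
  ∑ (A outside) + ∑ (A inside)
    ≡⟨ cong₂ _+_ (∑-splits S (f ∘ (outside ∷_))) (∑-splits S (f ∘ (inside ∷_))) ⟨
  ∑ f ∎)
  where
  open ≡-Reasoning
  A : Bool → Subset n → ℕ
  A k J = ∑ λ K → if splits S J K then f (k ∷ J ∪ K) else 0

select : Subset n → (Fin n → ℕ) → (Fin n → ℕ) → Fin n → ℕ
select I p m x = if lookup I x then p x else m x

prodOn-cong-on : ∀ (X : Subset n) {f g : Fin n → ℕ} → (∀ {x} → x ∈ X → f x ≡ g x) →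
                 prodOn X f ≡ prodOn X g
prodOn-cong-on []            f≗g = refl
prodOn-cong-on (inside ∷ X)  f≗g = cong₂ _*_ (f≗g here) (prodOn-cong-on X (f≗g ∘ there))
prodOn-cong-on (outside ∷ X) f≗g = prodOn-cong-on X (f≗g ∘ there)

prodOn-select : ∀ {X I : Subset n} (p m : Fin n → ℕ) → I ⊆ X →
                prodOn I p * prodOn (X ─ I) m ≡ prodOn X (select I p m)
prodOn-select {X = []}          {[]}          p m _   = refl
prodOn-select {X = inside ∷ X}  {inside ∷ I}  p m I⊆X =
  trans (*-assoc (p zero) _ _) (cong (p zero *_) (prodOn-select (p ∘ suc) (m ∘ suc) (drop-∷-⊆ I⊆X)))
prodOn-select {X = inside ∷ X}  {outside ∷ I} p m I⊆X =
  trans (*-CS.x∙yz≈y∙xz (prodOn I (p ∘ suc)) (m zero) _)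
        (cong (m zero *_) (prodOn-select (p ∘ suc) (m ∘ suc) (drop-∷-⊆ I⊆X)))
prodOn-select {X = outside ∷ X} {outside ∷ I} p m I⊆X = prodOn-select (p ∘ suc) (m ∘ suc) (drop-∷-⊆ I⊆X)
prodOn-select {X = outside ∷ X} {inside ∷ I}  p m I⊆X = contradiction (I⊆X here) λ ()

prodOn-select-splits : ∀ {V S J K : Subset n} (p m : Fin n → ℕ) → T (splits S J K) → S ⊆ V →
                       prodOn V (select (J ∪ K) p m)
                         ≡ prodOn S (select J p m) * prodOn (V ─ S) (select K p m)
prodOn-select-splits {V = []} {[]} {[]} {[]} p m _ _ = refl
prodOn-select-splits {V = inside ∷ V} {inside ∷ S} {inside ∷ J} {outside ∷ K} p m sp S⊆V =
  trans (cong (p zero *_) (prodOn-select-splits (p ∘ suc) (m ∘ suc) sp (drop-∷-⊆ S⊆V)))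
        (sym (*-assoc (p zero) _ _))
prodOn-select-splits {V = inside ∷ V} {inside ∷ S} {outside ∷ J} {outside ∷ K} p m sp S⊆V =
  trans (cong (m zero *_) (prodOn-select-splits (p ∘ suc) (m ∘ suc) sp (drop-∷-⊆ S⊆V)))
        (sym (*-assoc (m zero) _ _))
prodOn-select-splits {V = outside ∷ V} {inside ∷ S} p m sp S⊆V = contradiction (S⊆V here) λ ()
prodOn-select-splits {V = inside ∷ V} {outside ∷ S} {outside ∷ J} {k ∷ K} p m sp S⊆V =
  trans (cong (select (k ∷ K) p m zero *_) (prodOn-select-splits (p ∘ suc) (m ∘ suc) sp (drop-∷-⊆ S⊆V)))
        (*-CS.x∙yz≈y∙xz (select (k ∷ K) p m zero) (prodOn S (select J (p ∘ suc) (m ∘ suc))) _)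
prodOn-select-splits {V = outside ∷ V} {outside ∷ S} {outside ∷ J} {k ∷ K} p m sp S⊆V =
  prodOn-select-splits (p ∘ suc) (m ∘ suc) sp (drop-∷-⊆ S⊆V)

prodOn-select-avoiding : ∀ {X Y J : Subset n} (p m : Fin n → ℕ) → J ⊆ X ─ Y →
                         prodOn X (select J p m) ≡ prodOn (X ∩ Y) m * prodOn (X ─ Y) (select J p m)
prodOn-select-avoiding {X = []} {[]} {[]} p m _ = refl
prodOn-select-avoiding {X = inside ∷ X} {inside ∷ Y} {outside ∷ J} p m J⊆X─Y =
  trans (cong (m zero *_) (prodOn-select-avoiding (p ∘ suc) (m ∘ suc) (drop-∷-⊆ J⊆X─Y)))
        (sym (*-assoc (m zero) _ _))
prodOn-select-avoiding {X = inside ∷ X} {outside ∷ Y} {j ∷ J} p m J⊆X─Y =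
  trans (cong (select (j ∷ J) p m zero *_) (prodOn-select-avoiding (p ∘ suc) (m ∘ suc) (drop-∷-⊆ J⊆X─Y)))
        (*-CS.x∙yz≈y∙xz (select (j ∷ J) p m zero) (prodOn (X ∩ Y) (m ∘ suc)) _)
prodOn-select-avoiding {X = outside ∷ X} {inside ∷ Y} {outside ∷ J} p m J⊆X─Y =
  prodOn-select-avoiding (p ∘ suc) (m ∘ suc) (drop-∷-⊆ J⊆X─Y)
prodOn-select-avoiding {X = outside ∷ X} {outside ∷ Y} {outside ∷ J} p m J⊆X─Y =
  prodOn-select-avoiding (p ∘ suc) (m ∘ suc) (drop-∷-⊆ J⊆X─Y)
prodOn-select-avoiding {X = x ∷ X} {inside ∷ Y} {inside ∷ J} p m J⊆X─Y = contradiction (J⊆X─Y here) λ ()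
prodOn-select-avoiding {X = outside ∷ X} {outside ∷ Y} {inside ∷ J} p m J⊆X─Y =
  contradiction (J⊆X─Y here) λ ()

upd-≡ : ∀ (f : Fin n → ℕ) v y → upd f v y v ≡ y
upd-≡ f v y with v ≟ v
... | yes _   = refl
... | no v≢v = contradiction refl v≢v

upd-≢ : ∀ (f : Fin n → ℕ) {v} y {x} → x ≢ v → upd f v y x ≡ f x
upd-≢ f {v} y {x} x≢v with x ≟ v
... | yes x≡v = contradiction x≡v x≢v
... | no _    = refl

prodOn-update : ∀ {X : Subset n} {v} {f g : Fin n → ℕ} c → v ∈ X →
                (∀ {x} → x ≢ v → g x ≡ f x) → g v ≡ f v * c → prodOn X g ≡ prodOn X f * c
prodOn-update {X = inside ∷ X} {f = f} c here g≗f gv =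
  trans (cong₂ _*_ gv (prodOn-cong-on X λ _ → g≗f λ ())) (*-CS.xy∙z≈xz∙y (f zero) c _)
prodOn-update {X = inside ∷ X} {f = f} c (there v∈X) g≗f gv =
  trans (cong₂ _*_ (g≗f λ ()) (prodOn-update c v∈X (λ x≢v → g≗f (x≢v ∘ suc-injective)) gv))
        (sym (*-assoc (f zero) _ c))
prodOn-update {X = outside ∷ X} c (there v∈X) g≗f gv =
  prodOn-update c v∈X (λ x≢v → g≗f (x≢v ∘ suc-injective)) gv

module IndependentSets (a : Fin n → Fin n → Bool) (a-sym : ∀ u v → a u v ≡ a v u) where

  Admissible : Subset n → Subset n → Set
  Admissible X I = I ⊆ X × Independent a I

  CrossFree : Subset n → Subset n → Set
  CrossFree J K = ∀ {i j} → i ∈ J → j ∈ K → ¬ T (a i j)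

  adm : Subset n → Subset n → Bool
  adm X I = subsetB I X ∧ independentB a I

  adm-sound : ∀ {X I} → T (adm X I) → Admissible X I
  adm-sound t = let s , i = Equivalence.to T-∧ t in subsetB-sound s , independentB-sound a i

  adm-complete : ∀ {X I} → Admissible X I → T (adm X I)
  adm-complete (I⊆X , ind) = Equivalence.from T-∧ (subsetB-complete I⊆X , independentB-complete a ind)

  admissible? : ∀ X I → Dec (Admissible X I)
  admissible? X I = map′ adm-sound adm-complete (T? (adm X I))

  independent-⊆ : ∀ {I J} → J ⊆ I → Independent a I → Independent a J
  independent-⊆ J⊆I ind i∈J j∈J = ind (J⊆I i∈J) (J⊆I j∈J)

  module _ {V S J K : Subset n} (sp : T (splits S J K)) where

    admissible-restrictˡ : Admissible V (J ∪ K) → Admissible S J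
    admissible-restrictˡ (_ , ind) = splits⇒⊆ sp , independent-⊆ (p⊆p∪q K) ind

    admissible-restrictʳ : Admissible V (J ∪ K) → Admissible (V ─ S) K
    admissible-restrictʳ (J∪K⊆V , ind) =
      (λ x∈K → x∈p∧x∉q⇒x∈p─q (J∪K⊆V (q⊆p∪q J K x∈K)) (splits⇒disjoint sp x∈K)) ,
      independent-⊆ (q⊆p∪q J K) ind

  admissible-combine : ∀ {V S J K} → S ⊆ V → Admissible S J → Admissible (V ─ S) K → CrossFree J K →
                       Admissible V (J ∪ K)
  admissible-combine {V} {S} {J} {K} S⊆V (J⊆S , indJ) (K⊆V─S , indK) cross = J∪K⊆V , indJ∪K
    where
    J∪K⊆V : J ∪ K ⊆ V
    J∪K⊆V x∈J∪K with x∈p∪q⁻ J K x∈J∪K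
    ... | inj₁ x∈J = S⊆V (J⊆S x∈J)
    ... | inj₂ x∈K = p─q⊆p V S (K⊆V─S x∈K)
    indJ∪K : Independent a (J ∪ K)
    indJ∪K i∈J∪K j∈J∪K with x∈p∪q⁻ J K i∈J∪K | x∈p∪q⁻ J K j∈J∪K
    ... | inj₁ i∈J | inj₁ j∈J = indJ i∈J j∈J
    ... | inj₁ i∈J | inj₂ j∈K = cross i∈J j∈K
    ... | inj₂ i∈K | inj₁ j∈J = cross j∈J i∈K ∘ subst T (a-sym _ _)
    ... | inj₂ i∈K | inj₂ j∈K = indK i∈K j∈K

  module Weighted (p m : Fin n → ℕ) where

    term : Subset n → Subset n → ℕ
    term X I = if adm X I then prodOn I p * prodOn (X ─ I) m else 0

    Zon≡∑term : ∀ X W → Zon a X p m W ≡ W * ∑ (term X)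
    Zon≡∑term X W = cong (W *_) (sum-allSubsets (term X))

    term-admissible : ∀ {X I} → Admissible X I → term X I ≡ prodOn X (select I p m)
    term-admissible admI = trans (if-T (adm-complete admI)) (prodOn-select p m (proj₁ admI))

    term-inadmissible : ∀ {X I} → ¬ Admissible X I → term X I ≡ 0
    term-inadmissible ¬admI = if-¬T (¬admI ∘ adm-sound)

    term-avoiding : ∀ {S N J} → Admissible (S ─ N) J → term S J ≡ prodOn (S ∩ N) m * term (S ─ N) J
    term-avoiding {S} {N} {J} admJ@(J⊆S─N , indJ) = begin
      term S J                                         ≡⟨ term-admissible (p─q⊆p S N ∘ J⊆S─N , indJ) ⟩
      prodOn S (select J p m)                          ≡⟨ prodOn-select-avoiding p m J⊆S─N ⟩
      prodOn (S ∩ N) m * prodOn (S ─ N) (select J p m) ≡⟨ cong (prodOn (S ∩ N) m *_) (term-admissible admJ) ⟨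
      prodOn (S ∩ N) m * term (S ─ N) J                ∎
      where open ≡-Reasoning

    ∑-term-avoiding-≤ : ∀ S N → prodOn (S ∩ N) m * ∑ (term (S ─ N)) ≤ ∑ (term S)
    ∑-term-avoiding-≤ S N = begin
      c * ∑ (term (S ─ N))         ≡⟨ ∑-*ˡ c (term (S ─ N)) ⟨
      ∑ (λ J → c * term (S ─ N) J) ≤⟨ ∑-mono termwise ⟩
      ∑ (term S)                   ∎
      where
      open ≤-Reasoning
      c = prodOn (S ∩ N) m
      termwise : ∀ J → c * term (S ─ N) J ≤ term S J
      termwise J with admissible? (S ─ N) J
      ... | yes admJ  = ≤-reflexive (sym (term-avoiding admJ))
      ... | no  ¬admJ =
        subst (_≤ term S J) (sym (trans (cong (c *_) (term-inadmissible ¬admJ)) (*-zeroʳ c))) z≤n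

    module _ {V S : Subset n} (S⊆V : S ⊆ V) where

      pairTerm : Subset n → Subset n → ℕ
      pairTerm J K = if splits S J K then term V (J ∪ K) else 0

      pairTerm-vanishes : ∀ {J K} → (T (splits S J K) → ¬ Admissible V (J ∪ K)) → pairTerm J K ≡ 0
      pairTerm-vanishes {J} {K} ¬adm with T? (splits S J K)
      ... | yes sp  = trans (if-T sp) (term-inadmissible (¬adm sp))
      ... | no  ¬sp = if-¬T ¬sp

      pairTerm-factor : ∀ {J K} → (Admissible S J → Admissible (V ─ S) K → CrossFree J K) →
                        pairTerm J K ≡ term S J * term (V ─ S) K
      pairTerm-factor {J} {K} cross with admissible? S J | admissible? (V ─ S) K
      ... | yes admJ | yes admK = begin
        pairTerm J K
          ≡⟨ if-T sp ⟩
        term V (J ∪ K)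
          ≡⟨ term-admissible (admissible-combine S⊆V admJ admK (cross admJ admK)) ⟩
        prodOn V (select (J ∪ K) p m)
          ≡⟨ prodOn-select-splits p m sp S⊆V ⟩
        prodOn S (select J p m) * prodOn (V ─ S) (select K p m)
          ≡⟨ cong₂ _*_ (term-admissible admJ) (term-admissible admK) ⟨
        term S J * term (V ─ S) K ∎
        where
        open ≡-Reasoning
        sp : T (splits S J K)
        sp = splits-complete (proj₁ admJ) (x∈p─q⇒x∉q ∘ proj₁ admK)
      ... | no ¬admJ | _        = begin
        pairTerm J K              ≡⟨ pairTerm-vanishes (λ sp → ¬admJ ∘ admissible-restrictˡ sp) ⟩
        0                         ≡⟨ cong (_* term (V ─ S) K) (term-inadmissible ¬admJ) ⟨
        term S J * term (V ─ S) K ∎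
        where open ≡-Reasoning
      ... | yes _    | no ¬admK = begin
        pairTerm J K              ≡⟨ pairTerm-vanishes (λ sp → ¬admK ∘ admissible-restrictʳ sp) ⟩
        0                         ≡⟨ *-zeroʳ (term S J) ⟨
        term S J * 0              ≡⟨ cong (term S J *_) (term-inadmissible ¬admK) ⟨
        term S J * term (V ─ S) K ∎
        where open ≡-Reasoning

      ∑-term-isolated : (∀ {i j} → i ∈ S → j ∈ V ─ S → ¬ T (a i j)) →
                        ∑ (term V) ≡ ∑ (term S) * ∑ (term (V ─ S))
      ∑-term-isolated no-edge = begin
        ∑ (term V)                             ≡⟨ ∑-splits S (term V) ⟩
        ∑₂ pairTerm                            ≡⟨ ∑-cong {n} (λ J → ∑-cong λ K → pairTerm-factor {J} {K} cross) ⟩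
        ∑₂ (λ J K → term S J * term (V ─ S) K) ≡⟨ ∑-cong (λ J → ∑-*ˡ (term S J) (term (V ─ S))) ⟩
        ∑ (λ J → term S J * ∑ (term (V ─ S)))  ≡⟨ ∑-*ʳ (∑ (term (V ─ S))) (term S) ⟩
        ∑ (term S) * ∑ (term (V ─ S))          ∎
        where
        open ≡-Reasoning
        cross : ∀ {J K} → Admissible S J → Admissible (V ─ S) K → CrossFree J K
        cross (J⊆S , _) (K⊆V─S , _) i∈J j∈K = no-edge (J⊆S i∈J) (K⊆V─S j∈K)

      module _ {v : Fin n} {N : Subset n}
               (edge⇒v : ∀ {i j} → i ∈ S → j ∈ V ─ S → T (a i j) → j ≡ v)
               (N-sound : ∀ {i} → i ∈ N → T (a i v))
               (N-complete : ∀ {i} → i ∈ S → T (a i v) → i ∈ N) where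

        private
          c : ℕ
          c = prodOn (S ∩ N) m

        pairTerm-∉ : ∀ {J K} → v ∉ K → pairTerm J K ≡ term S J * term (V ─ S) K
        pairTerm-∉ {J} {K} v∉K = pairTerm-factor cross
          where
          cross : Admissible S J → Admissible (V ─ S) K → CrossFree J K
          cross (J⊆S , _) (K⊆V─S , _) i∈J j∈K aij =
            v∉K (subst (_∈ K) (edge⇒v (J⊆S i∈J) (K⊆V─S j∈K) aij) j∈K)

        pairTerm-∈ : ∀ {J K} → v ∈ K → pairTerm J K ≡ c * term (S ─ N) J * term (V ─ S) K
        pairTerm-∈ {J} {K} v∈K with admissible? (S ─ N) J
        ... | yes admJ@(J⊆S─N , _) =
          trans (pairTerm-factor cross) (cong (_* term (V ─ S) K) (term-avoiding admJ))
          where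
          cross : Admissible S J → Admissible (V ─ S) K → CrossFree J K
          cross _ (K⊆V─S , _) {i} i∈J j∈K aij = x∈p─q⇒x∉q i∈S─N (N-complete (p─q⊆p S N i∈S─N) aiv)
            where
            i∈S─N = J⊆S─N i∈J
            aiv = subst (T ∘ a i) (edge⇒v (p─q⊆p S N i∈S─N) (K⊆V─S j∈K) aij) aij
        ... | no ¬admJ = begin
          pairTerm J K                         ≡⟨ pairTerm-vanishes (λ sp → ¬admJ ∘ avoids sp) ⟩
          0                                    ≡⟨ cong (_* term (V ─ S) K) (*-zeroʳ c) ⟨
          c * 0 * term (V ─ S) K               ≡⟨ cong (λ t → c * t * _) (term-inadmissible ¬admJ) ⟨
          c * term (S ─ N) J * term (V ─ S) K  ∎
          where
          open ≡-Reasoning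
          avoids : T (splits S J K) → Admissible V (J ∪ K) → Admissible (S ─ N) J
          avoids sp (_ , ind) =
            (λ x∈J → x∈p∧x∉q⇒x∈p─q (splits⇒⊆ sp x∈J)
                       λ x∈N → ind (p⊆p∪q K x∈J) (q⊆p∪q J K v∈K) (N-sound x∈N)) ,
            independent-⊆ (p⊆p∪q K) ind

        ∑ᴶ-pairTerm : ∀ K → ∑ (λ J → pairTerm J K)
                            ≡ term (V ─ S) K * (if lookup K v then c * ∑ (term (S ─ N)) else ∑ (term S))
        ∑ᴶ-pairTerm K with lookup K v in v∈?K
        ... | true  = begin
          ∑ (λ J → pairTerm J K)
            ≡⟨ ∑-cong (λ J → pairTerm-∈ {J} (lookup⇒[]= v K v∈?K)) ⟩
          ∑ (λ J → c * term (S ─ N) J * term (V ─ S) K)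
            ≡⟨ ∑-*ʳ (term (V ─ S) K) (λ J → c * term (S ─ N) J) ⟩
          ∑ (λ J → c * term (S ─ N) J) * term (V ─ S) K
            ≡⟨ cong (_* term (V ─ S) K) (∑-*ˡ c (term (S ─ N))) ⟩
          c * ∑ (term (S ─ N)) * term (V ─ S) K
            ≡⟨ *-comm _ (term (V ─ S) K) ⟩
          term (V ─ S) K * (c * ∑ (term (S ─ N))) ∎
          where open ≡-Reasoning
        ... | false = begin
          ∑ (λ J → pairTerm J K)              ≡⟨ ∑-cong (λ J → pairTerm-∉ {J} v∉K) ⟩
          ∑ (λ J → term S J * term (V ─ S) K) ≡⟨ ∑-*ʳ (term (V ─ S) K) (term S) ⟩
          ∑ (term S) * term (V ─ S) K         ≡⟨ *-comm (∑ (term S)) (term (V ─ S) K) ⟩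
          term (V ─ S) K * ∑ (term S)         ∎
          where
          open ≡-Reasoning
          v∉K : v ∉ K
          v∉K v∈K = contradiction (trans (sym ([]=⇒lookup v∈K)) v∈?K) λ ()

        ∑-term-attached : ∑ (term V)
                          ≡ ∑ λ K → term (V ─ S) K * (if lookup K v then c * ∑ (term (S ─ N)) else ∑ (term S))
        ∑-term-attached = begin
          ∑ (term V)                ≡⟨ ∑-splits S (term V) ⟩
          ∑₂ pairTerm               ≡⟨ ∑-swap pairTerm ⟩
          ∑₂ (λ K J → pairTerm J K) ≡⟨ ∑-cong ∑ᴶ-pairTerm ⟩
          _                         ∎
          where open ≡-Reasoning

  term-reweight : ∀ {p m : Fin n → ℕ} {X K v} c⁺ c⁻ {y z} → v ∈ X → y ≡ p v * c⁺ → z ≡ m v * c⁻ →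
                  Weighted.term (upd p v y) (upd m v z) X K
                    ≡ Weighted.term p m X K * (if lookup K v then c⁺ else c⁻)
  term-reweight {p} {m} {X} {K} {v} c⁺ c⁻ {y} {z} v∈X y≡ z≡ with admissible? X K
  ... | no ¬admK = trans (W′.term-inadmissible ¬admK) (sym (cong (_* _) (W.term-inadmissible ¬admK)))
    where
    module W  = Weighted p m
    module W′ = Weighted (upd p v y) (upd m v z)
  ... | yes admK = begin
    W′.term X K                                               ≡⟨ W′.term-admissible admK ⟩
    prodOn X (select K (upd p v y) (upd m v z))               ≡⟨ prodOn-update c± v∈X away at-v ⟩
    prodOn X (select K p m) * c±                              ≡⟨ cong (_* c±) (W.term-admissible admK) ⟨
    W.term X K * c±                                           ∎
    where
    open ≡-Reasoning
    module W  = Weighted p m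
    module W′ = Weighted (upd p v y) (upd m v z)
    c± = if lookup K v then c⁺ else c⁻
    away : ∀ {x} → x ≢ v → select K (upd p v y) (upd m v z) x ≡ select K p m x
    away {x} x≢v = cong₂ (λ s t → if lookup K x then s else t) (upd-≢ p y x≢v) (upd-≢ m z x≢v)
    split-at-v : ∀ b → (if b then y else z) ≡ (if b then p v else m v) * (if b then c⁺ else c⁻)
    split-at-v true  = y≡
    split-at-v false = z≡
    at-v : select K (upd p v y) (upd m v z) v ≡ select K p m v * c±
    at-v = trans (cong₂ (λ s t → if lookup K v then s else t) (upd-≡ p v y) (upd-≡ m v z))
                 (split-at-v (lookup K v))

module _ (𝒢 : WGraph n) where

  ∈-nbr⁻ : ∀ {v i} → i ∈ nbr 𝒢 v → T (adj 𝒢 v i)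
  ∈-nbr⁻ {v} {i} i∈N = proj₂ (Equivalence.to T-∧ (subst T (lookup∘tabulate _ i) (∈⇒T-lookup i∈N)))

  ∈-nbr⁺ : ∀ {v i} → i ∈ V 𝒢 → T (adj 𝒢 v i) → i ∈ nbr 𝒢 v
  ∈-nbr⁺ {v} {i} i∈V avi =
    T-lookup⇒∈ (subst T (sym (lookup∘tabulate _ i)) (Equivalence.from T-∧ (∈⇒T-lookup i∈V , avi)))

  ∈-nbrSet⁻ : ∀ {S j} → j ∈ nbrSet 𝒢 S → j ∈ V 𝒢 ─ S
  ∈-nbrSet⁻ {S} {j} j∈Γ with Equivalence.to T-∧ (subst T (lookup∘tabulate _ j) (∈⇒T-lookup j∈Γ))
  ... | j∈V , rest =
    x∈p∧x∉q⇒x∈p─q (T-lookup⇒∈ j∈V) (T-not-lookup⇒∉ (proj₁ (Equivalence.to T-∧ rest)))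

  ∈-nbrSet⁺ : ∀ {S i j} → i ∈ S → i ∈ V 𝒢 → T (adj 𝒢 i j) → j ∈ V 𝒢 → j ∉ S → j ∈ nbrSet 𝒢 S
  ∈-nbrSet⁺ {S} {i} {j} i∈S i∈V aij j∈V j∉S =
    T-lookup⇒∈ (subst T (sym (lookup∘tabulate _ j))
      (Equivalence.from T-∧ (∈⇒T-lookup j∈V , Equivalence.from T-∧ (∉⇒T-not-lookup j∉S , i-witness))))
    where
    i-witness = any-allFin⁺ (λ u → lookup S u ∧ lookup (V 𝒢) u ∧ adj 𝒢 u j) i
                  (Equivalence.from T-∧ (∈⇒T-lookup i∈S , Equivalence.from T-∧ (∈⇒T-lookup i∈V , aij)))

module Pruning (𝒢 : WGraph n) {S : Subset n} (S⊆V : S ⊆ V 𝒢) where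
  open IndependentSets (adj 𝒢) (adj-sym 𝒢)
  open Weighted (w+ 𝒢) (w- 𝒢)

  Zon₁≡∑term : ∀ X → Zon (adj 𝒢) X (w+ 𝒢) (w- 𝒢) 1 ≡ ∑ (term X)
  Zon₁≡∑term X = trans (Zon≡∑term X 1) (*-identityˡ (∑ (term X)))

  edge⇒Γ : ∀ {i j} → i ∈ S → j ∈ V 𝒢 ─ S → T (adj 𝒢 i j) → j ∈ nbrSet 𝒢 S
  edge⇒Γ i∈S j∈V─S aij =
    ∈-nbrSet⁺ 𝒢 i∈S (S⊆V i∈S) aij (p─q⊆p (V 𝒢) S j∈V─S) (x∈p─q⇒x∉q j∈V─S)

  module Isolated (Γ-empty : ∀ {u} → u ∉ nbrSet 𝒢 S) where

    pruned : WGraph n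
    pruned = record 𝒢 { V = V 𝒢 ─ S ; W = Zon (adj 𝒢) S (w+ 𝒢) (w- 𝒢) (W 𝒢) }

    Z-pruned : Z pruned ≡ Z 𝒢
    Z-pruned = begin
      Z pruned
        ≡⟨ Zon≡∑term (V 𝒢 ─ S) (Zon (adj 𝒢) S (w+ 𝒢) (w- 𝒢) (W 𝒢)) ⟩
      Zon (adj 𝒢) S (w+ 𝒢) (w- 𝒢) (W 𝒢) * ∑ (term (V 𝒢 ─ S))
        ≡⟨ cong (_* ∑ (term (V 𝒢 ─ S))) (Zon≡∑term S (W 𝒢)) ⟩
      W 𝒢 * ∑ (term S) * ∑ (term (V 𝒢 ─ S))
        ≡⟨ *-assoc (W 𝒢) _ _ ⟩
      W 𝒢 * (∑ (term S) * ∑ (term (V 𝒢 ─ S)))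
        ≡⟨ cong (W 𝒢 *_) (∑-term-isolated S⊆V λ i∈S j∈V─S → Γ-empty ∘ edge⇒Γ i∈S j∈V─S) ⟨
      W 𝒢 * ∑ (term (V 𝒢))
        ≡⟨ Zon≡∑term (V 𝒢) (W 𝒢) ⟨
      Z 𝒢 ∎
      where open ≡-Reasoning

    balanced-pruned : OneBalanced 𝒢 → OneBalanced pruned
    balanced-pruned balanced x x∈V─S = balanced x (p─q⊆p (V 𝒢) S x∈V─S)

  module Attached {v} (v∈Γ : v ∈ nbrSet 𝒢 S) (∣Γ∣≤1 : ∣ nbrSet 𝒢 S ∣ ≤ 1) where

    N : Subset n
    N = nbr 𝒢 v

    pruned : WGraph n
    pruned = record 𝒢
      { V  = V 𝒢 ─ S
      ; w+ = upd (w+ 𝒢) v (w+ 𝒢 v * prodOn (S ∩ N) (w- 𝒢) * Zon (adj 𝒢) (S ─ N) (w+ 𝒢) (w- 𝒢) 1)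
      ; w- = upd (w- 𝒢) v (w- 𝒢 v * Zon (adj 𝒢) S (w+ 𝒢) (w- 𝒢) 1)
      }

    c⁺ c⁻ : ℕ
    c⁺ = prodOn (S ∩ N) (w- 𝒢) * ∑ (term (S ─ N))
    c⁻ = ∑ (term S)

    w+v≡ : w+ 𝒢 v * prodOn (S ∩ N) (w- 𝒢) * Zon (adj 𝒢) (S ─ N) (w+ 𝒢) (w- 𝒢) 1 ≡ w+ 𝒢 v * c⁺
    w+v≡ = trans (*-assoc (w+ 𝒢 v) _ _)
                 (cong (λ t → w+ 𝒢 v * (prodOn (S ∩ N) (w- 𝒢) * t)) (Zon₁≡∑term (S ─ N)))

    w-v≡ : w- 𝒢 v * Zon (adj 𝒢) S (w+ 𝒢) (w- 𝒢) 1 ≡ w- 𝒢 v * c⁻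
    w-v≡ = cong (w- 𝒢 v *_) (Zon₁≡∑term S)

    v∈V─S : v ∈ V 𝒢 ─ S
    v∈V─S = ∈-nbrSet⁻ 𝒢 v∈Γ

    edge⇒v : ∀ {i j} → i ∈ S → j ∈ V 𝒢 ─ S → T (adj 𝒢 i j) → j ≡ v
    edge⇒v i∈S j∈V─S aij = ∣p∣≤1⇒x≡y ∣Γ∣≤1 (edge⇒Γ i∈S j∈V─S aij) v∈Γ

    N-sound : ∀ {i} → i ∈ N → T (adj 𝒢 i v)
    N-sound {i} i∈N = subst T (adj-sym 𝒢 v i) (∈-nbr⁻ 𝒢 i∈N)

    N-complete : ∀ {i} → i ∈ S → T (adj 𝒢 i v) → i ∈ N
    N-complete {i} i∈S aiv = ∈-nbr⁺ 𝒢 (S⊆V i∈S) (subst T (adj-sym 𝒢 i v) aiv)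

    Z-pruned : Z pruned ≡ Z 𝒢
    Z-pruned = begin
      Z pruned
        ≡⟨ Weighted.Zon≡∑term (w+ pruned) (w- pruned) (V 𝒢 ─ S) (W 𝒢) ⟩
      W 𝒢 * ∑ (Weighted.term (w+ pruned) (w- pruned) (V 𝒢 ─ S))
        ≡⟨ cong (W 𝒢 *_) (∑-cong {n} λ K → term-reweight {K = K} c⁺ c⁻ v∈V─S w+v≡ w-v≡) ⟩
      W 𝒢 * ∑ (λ K → term (V 𝒢 ─ S) K * (if lookup K v then c⁺ else c⁻))
        ≡⟨ cong (W 𝒢 *_) (∑-term-attached S⊆V edge⇒v N-sound N-complete) ⟨
      W 𝒢 * ∑ (term (V 𝒢))
        ≡⟨ Zon≡∑term (V 𝒢) (W 𝒢) ⟨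
      Z 𝒢 ∎
      where open ≡-Reasoning

    -- The test x ≟ v is the one inside upd, so each branch sees the pruned weights reduced.
    balanced-pruned : OneBalanced 𝒢 → OneBalanced pruned
    balanced-pruned balanced x x∈V─S with x ≟ v
    ... | yes refl = subst₂ _≤_ (sym w+v≡) (sym w-v≡)
                       (*-mono-≤ (balanced v (p─q⊆p (V 𝒢) S v∈V─S)) (∑-term-avoiding-≤ S N))
    ... | no _     = balanced x (p─q⊆p (V 𝒢) S x∈V─S)

lemma29 : ∀ {n} (𝒢 : WGraph n) (S : Subset n) →
          IsWeighted 𝒢 → OneBalanced 𝒢 →
          S ⊆ V 𝒢 → ∣ nbrSet 𝒢 S ∣ ≤ 1 →
          Z (Prune 𝒢 S) ≡ Z 𝒢 × OneBalanced (Prune 𝒢 S)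
lemma29 𝒢 S _ balanced S⊆V ∣Γ∣≤1 with firstIn (nbrSet 𝒢 S) in Γ-first
... | nothing = Z-pruned , balanced-pruned balanced
  where open Pruning.Isolated 𝒢 S⊆V (firstIn-nothing Γ-first)
... | just v  = Z-pruned , balanced-pruned balanced
  where open Pruning.Attached 𝒢 S⊆V (firstIn-just Γ-first) ∣Γ∣≤1
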